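{- Let $n\ge 3$ and let $\mathcal{H}=(V,\mathcal{E})$ be a $5$-uniform hypergraph with $EI(\mathcal{H})=C_n$ such that every hyperedge of $\mathcal{H}$ is a $(3,2)$-hyperedge. Then $|\mathcal{E}|\ge\frac{2n}{3}$.
   Context: Hypergraphs $\mathcal{H}=(V,\mathcal{E})$ have no multiple hyperedges; isolated vertices are allowed. $\mathcal{H}$ is $5$-uniform if every hyperedge has exactly $5$ elements. The edge intersection hypergraph of $\mathcal{H}$ is $EI(\mathcal{H})=(V,\mathcal{E}^{EI})$ with $\mathcal{E}^{EI}=\{e_1\cap e_2: e_1,e_2\in\mathcal{E},\ e_1\ne e_2,\ |e_1\cap e_2|\ge 2\}$. $C_n$ is the cycle with vertex set $\{1,\dots,n\}$ and edges $\{i,i+1\}$, $i=1,\dots,n$ (vertices taken mod $n$); "$EI(\mathcal{H})=C_n$" means $V=\{1,\dots,n\}$ and $\mathcal{E}^{EI}$ is exactly the edge set of $C_n$. For $e\in\mathcal{E}$, a $k$-section of $e$ is a sequence $(i,i+1,\dots,i+k-1)$ of cyclically consecutive vertices with $\{i,\dots,i+k-1\}\subseteq e$, $i-1\notin e$, $i+k\notin e$ (mod $n$). A hyperedge $e$ is an $(l_1,\dots,l_t)$-hyperedge ($l_1\ge\dots\ge l_t$) if $e$ is the disjoint union of exactly $t$ sections, of cardinalities $l_1,\dots,l_t$. Thus a $(3,2)$-hyperedge consists of one $3$-section and one $2$-section. -}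

module Defs where

open import Data.Nat using (ℕ; zero; suc; _%_; _≤_; _*_)
open import Data.Nat.DivMod using (m%n<n)
open import Data.Fin using (Fin; toℕ; fromℕ<)
open import Data.Fin.Subset using (Subset; ⁅_⁆; _∪_; _∩_; ∣_∣; _⊆_; _∉_) renaming (⊥ to ∅)
open import Data.List using (List; length)
open import Data.List.Membership.Propositional using () renaming (_∈_ to _∈ᴸ_)
open import Data.List.Relation.Unary.Unique.Propositional using (Unique)
open import Data.Product using (Σ; ∃; ∃-syntax; _×_)
open import Relation.Binary.PropositionalEquality using (_≡_; _≢_)

-- cyclic successor on the vertex set {0,…,n-1} (vertex i+1 of the paper is Fin i)
next : ∀ {n} → Fin n → Fin n
next {suc m} i = fromℕ< (m%n<n (suc (toℕ i)) (suc m))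

iter : ∀ {A : Set} → ℕ → (A → A) → A → A
iter zero f x = x
iter (suc k) f x = f (iter k f x)

prev : ∀ {n} → Fin n → Fin n
prev {suc m} i = iter m next i

interval : ∀ {n} → Fin n → ℕ → Subset n
interval i zero = ∅
interval i (suc k) = ⁅ i ⁆ ∪ interval (next i) k

IsSection : ∀ {n} → Subset n → Fin n → ℕ → Set
IsSection e i k = interval i k ⊆ e × prev i ∉ e × iter k next i ∉ e

Is32Hyperedge : ∀ {n} → Subset n → Set
Is32Hyperedge e = ∃[ i ] ∃[ j ]
  ( IsSection e i 3 × IsSection e j 2
  × ∣ interval i 3 ∣ ≡ 3 × ∣ interval j 2 ∣ ≡ 2
  × interval i 3 ∩ interval j 2 ≡ ∅
  × e ≡ interval i 3 ∪ interval j 2 )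

cycleEdge : ∀ {n} → Fin n → Subset n
cycleEdge i = ⁅ i ⁆ ∪ ⁅ next i ⁆

-- hypergraph on vertex set Fin n: a duplicate-free list of hyperedges
Uniform : ∀ {n} → ℕ → List (Subset n) → Set
Uniform k E = ∀ e → e ∈ᴸ E → ∣ e ∣ ≡ k

EIisCycle : ∀ {n} → List (Subset n) → Set
EIisCycle {n} E =
  (∀ e₁ e₂ → e₁ ∈ᴸ E → e₂ ∈ᴸ E → e₁ ≢ e₂ → 2 ≤ ∣ e₁ ∩ e₂ ∣ →
     ∃[ i ] (e₁ ∩ e₂ ≡ cycleEdge i))
  × (∀ (i : Fin n) → ∃[ e₁ ] ∃[ e₂ ] (e₁ ∈ᴸ E × e₂ ∈ᴸ E × e₁ ≢ e₂ × e₁ ∩ e₂ ≡ cycleEdge i))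

-- Double count the pairs (e, i) with the cycle edge {i, i+1} inside the hyperedge e.
-- Every cycle edge is the intersection of two distinct hyperedges, so lies in at least
-- two of them: at least 2n pairs. A (3,2)-hyperedge has 5 vertices, and the last vertex
-- of each of its two sections has its successor outside e; only the remaining 3 vertices
-- i ∈ e can have i+1 ∈ e: at most 3|E| pairs.
module Submission where

open import Defs
open import Data.Nat using (ℕ; zero; suc; _+_; _≤_; _*_; z≤n)
open import Data.Nat.Properties
  using (≤-trans; ≤-reflexive; m≤m+n; +-mono-≤; +-monoʳ-≤; +-cancelʳ-≤; *-comm; +-0-commutativeMonoid; module ≤-Reasoning)
open import Data.Bool using (Bool; true; false; _∧_; not)
open import Data.Bool.Properties using (¬-not)
open import Data.Fin using (Fin; zero; suc; punchIn; punchOut)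
open import Data.Fin.Properties using (punchIn-punchOut)
open import Data.Fin.Subset using (Subset; _∈_; _∉_; _∩_; ⁅_⁆; ∣_∣)
open import Data.Fin.Subset.Properties using (x∈⁅x⁆; p⊆p∪q; q⊆p∪q; x∈p∩q⁻; x∈p∩q⁺; ∉⊥)
open import Data.Vec using ([]; _∷_; lookup)
open import Data.Vec.Properties using ([]=⇒lookup; lookup⇒[]=)
open import Data.List using (List; length) renaming (lookup to _!_)
open import Data.List.Membership.Propositional using () renaming (_∈_ to _∈ᴸ_)
open import Data.List.Membership.Propositional.Properties using (∈-lookup)
open import Data.List.Relation.Unary.Any using (index)
open import Data.List.Relation.Unary.Any.Properties using (lookup-index)
open import Data.List.Relation.Unary.Unique.Propositional using (Unique)
open import Data.Product using (_×_; _,_; proj₁; proj₂)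
open import Relation.Binary.PropositionalEquality using (_≡_; _≢_; refl; sym; trans; cong; subst; module ≡-Reasoning)
open import Algebra.Properties.CommutativeMonoid.Sum +-0-commutativeMonoid
  using (sum; sum-syntax; sum-remove; sum-cong-≗; ∑-distrib-+; ∑-comm)

∑-≤-* : ∀ {n} (f : Fin n → ℕ) {k} → (∀ i → f i ≤ k) → sum f ≤ n * k
∑-≤-* {zero} f _ = z≤n
∑-≤-* {suc n} f f≤k = +-mono-≤ (f≤k zero) (∑-≤-* (λ i → f (suc i)) (λ i → f≤k (suc i)))

*-≤-∑ : ∀ {n} (f : Fin n → ℕ) {k} → (∀ i → k ≤ f i) → n * k ≤ sum f
*-≤-∑ {zero} f _ = z≤n
*-≤-∑ {suc n} f k≤f = +-mono-≤ (k≤f zero) (*-≤-∑ (λ i → f (suc i)) (λ i → k≤f (suc i)))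

≤-∑ : ∀ {n} (f : Fin n → ℕ) i → f i ≤ sum f
≤-∑ {suc n} f i = ≤-trans (m≤m+n (f i) _) (≤-reflexive (sym (sum-remove f)))

2≤∑ : ∀ {n} (f : Fin n → ℕ) {i j} → i ≢ j → 1 ≤ f i → 1 ≤ f j → 2 ≤ sum f
2≤∑ {suc n} f {i} {j} i≢j 1≤fi 1≤fj = begin
  2                                          ≤⟨ +-mono-≤ 1≤fi 1≤fj′ ⟩
  f i + f (punchIn i (punchOut i≢j))         ≤⟨ +-monoʳ-≤ (f i) (≤-∑ (λ k → f (punchIn i k)) (punchOut i≢j)) ⟩
  f i + sum (λ k → f (punchIn i k))          ≡⟨ sym (sum-remove f) ⟩
  sum f                                      ∎
  where
  open ≤-Reasoning
  1≤fj′ : 1 ≤ f (punchIn i (punchOut i≢j))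
  1≤fj′ = subst (λ k → 1 ≤ f k) (sym (punchIn-punchOut i≢j)) 1≤fj

∑ᴸ : ∀ {A : Set} → List A → (A → ℕ) → ℕ
∑ᴸ xs h = sum (λ k → h (xs ! k))

2≤∑ᴸ : ∀ {A : Set} (xs : List A) (h : A → ℕ) {x y} → x ∈ᴸ xs → y ∈ᴸ xs → x ≢ y →
       1 ≤ h x → 1 ≤ h y → 2 ≤ ∑ᴸ xs h
2≤∑ᴸ xs h x∈xs y∈xs x≢y 1≤hx 1≤hy =
  2≤∑ (λ k → h (xs ! k)) index≢ (at x∈xs 1≤hx) (at y∈xs 1≤hy)
  where
  at : ∀ {z} (z∈xs : z ∈ᴸ xs) → 1 ≤ h z → 1 ≤ h (xs ! index z∈xs)
  at z∈xs = subst (λ w → 1 ≤ h w) (lookup-index z∈xs)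
  index≢ : index x∈xs ≢ index y∈xs
  index≢ eq = x≢y (trans (lookup-index x∈xs) (trans (cong (xs !_) eq) (sym (lookup-index y∈xs))))

𝟙 : Bool → ℕ
𝟙 true = 1
𝟙 false = 0

𝟙-split : ∀ a b → 𝟙 (a ∧ b) + 𝟙 (a ∧ not b) ≡ 𝟙 a
𝟙-split true true = refl
𝟙-split true false = refl
𝟙-split false b = refl

∣p∣≡∑𝟙 : ∀ {n} (p : Subset n) → ∣ p ∣ ≡ sum (λ i → 𝟙 (lookup p i))
∣p∣≡∑𝟙 [] = refl
∣p∣≡∑𝟙 (true ∷ p) = cong suc (∣p∣≡∑𝟙 p)
∣p∣≡∑𝟙 (false ∷ p) = ∣p∣≡∑𝟙 p

∉⇒lookup≡false : ∀ {n} {x : Fin n} {p : Subset n} → x ∉ p → lookup p x ≡ false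
∉⇒lookup≡false {x = x} {p} x∉p = ¬-not (λ eq → x∉p (lookup⇒[]= x p eq))

inner : ∀ {n} → Subset n → Fin n → ℕ
inner e i = 𝟙 (lookup e i ∧ lookup e (next i))

exit : ∀ {n} → Subset n → Fin n → ℕ
exit e i = 𝟙 (lookup e i ∧ not (lookup e (next i)))

inner-∈ : ∀ {n} (e : Subset n) {i} → i ∈ e → next i ∈ e → inner e i ≡ 1
inner-∈ e i∈e i+1∈e rewrite []=⇒lookup i∈e | []=⇒lookup i+1∈e = refl

exit-∈-∉ : ∀ {n} (e : Subset n) {i} → i ∈ e → next i ∉ e → exit e i ≡ 1
exit-∈-∉ e i∈e i+1∉e rewrite []=⇒lookup i∈e | ∉⇒lookup≡false i+1∉e = refl

∑inner+∑exit≡∣e∣ : ∀ {n} (e : Subset n) → sum (inner e) + sum (exit e) ≡ ∣ e ∣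
∑inner+∑exit≡∣e∣ e = begin
  sum (inner e) + sum (exit e)           ≡⟨ sym (∑-distrib-+ (inner e) (exit e)) ⟩
  sum (λ i → inner e i + exit e i)       ≡⟨ sum-cong-≗ (λ i → 𝟙-split (lookup e i) (lookup e (next i))) ⟩
  sum (λ i → 𝟙 (lookup e i))             ≡⟨ sym (∣p∣≡∑𝟙 e) ⟩
  ∣ e ∣                                  ∎
  where open ≡-Reasoning

2≤∑exit : ∀ {n} (e : Subset n) → Is32Hyperedge e → 2 ≤ sum (exit e)
2≤∑exit e (a , b , (Ia⊆e , _ , a+3∉e) , (Ib⊆e , _ , b+2∉e) , _ , _ , Ia∩Ib≡∅ , _) =
  2≤∑ (exit e) a+2≢b+1
    (≤-reflexive (sym (exit-∈-∉ e (Ia⊆e a+2∈Ia) a+3∉e)))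
    (≤-reflexive (sym (exit-∈-∉ e (Ib⊆e b+1∈Ib) b+2∉e)))
  where
  a+2∈Ia : next (next a) ∈ interval a 3
  a+2∈Ia = q⊆p∪q ⁅ a ⁆ _ (q⊆p∪q ⁅ next a ⁆ _ (p⊆p∪q _ (x∈⁅x⁆ _)))
  b+1∈Ib : next b ∈ interval b 2
  b+1∈Ib = q⊆p∪q ⁅ b ⁆ _ (p⊆p∪q _ (x∈⁅x⁆ _))
  a+2≢b+1 : next (next a) ≢ next b
  a+2≢b+1 eq = ∉⊥ (subst (next b ∈_) Ia∩Ib≡∅
                     (x∈p∩q⁺ (subst (_∈ interval a 3) eq a+2∈Ia , b+1∈Ib)))

∑inner≤3 : ∀ {n} (e : Subset n) → ∣ e ∣ ≡ 5 → Is32Hyperedge e → sum (inner e) ≤ 3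
∑inner≤3 e ∣e∣≡5 e-32 = +-cancelʳ-≤ 2 (sum (inner e)) 3 (begin
  sum (inner e) + 2              ≤⟨ +-monoʳ-≤ (sum (inner e)) (2≤∑exit e e-32) ⟩
  sum (inner e) + sum (exit e)   ≡⟨ trans (∑inner+∑exit≡∣e∣ e) ∣e∣≡5 ⟩
  5                              ∎)
  where open ≤-Reasoning

inner-∩ : ∀ {n} (e₁ e₂ : Subset n) {i} → e₁ ∩ e₂ ≡ cycleEdge i → inner e₁ i ≡ 1 × inner e₂ i ≡ 1
inner-∩ e₁ e₂ {i} e₁∩e₂≡i,i+1 =
  inner-∈ e₁ (proj₁ i∈) (proj₁ i+1∈) , inner-∈ e₂ (proj₂ i∈) (proj₂ i+1∈)
  where
  ∈both : ∀ {x} → x ∈ cycleEdge i → x ∈ e₁ × x ∈ e₂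
  ∈both x∈ = x∈p∩q⁻ e₁ e₂ (subst (_ ∈_) (sym e₁∩e₂≡i,i+1) x∈)
  i∈ : i ∈ e₁ × i ∈ e₂
  i∈ = ∈both (p⊆p∪q _ (x∈⁅x⁆ i))
  i+1∈ : next i ∈ e₁ × next i ∈ e₂
  i+1∈ = ∈both (q⊆p∪q ⁅ i ⁆ _ (x∈⁅x⁆ (next i)))

theorem7 : (n : ℕ) → 3 ≤ n → (E : List (Subset n)) → Unique E →
    Uniform 5 E → EIisCycle E → (∀ e → e ∈ᴸ E → Is32Hyperedge e) →
    2 * n ≤ 3 * length E
theorem7 n _ E _ uniform (_ , cycle⊆EI) all-32 = begin
  2 * n                                   ≡⟨ *-comm 2 n ⟩
  n * 2                                   ≤⟨ *-≤-∑ _ 2≤edge-count ⟩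
  ∑[ i < n ] ∑ᴸ E (λ e → inner e i)       ≡⟨ ∑-comm (λ k i → inner (E ! k) i) ⟨
  ∑ᴸ E (λ e → sum (inner e))              ≤⟨ ∑-≤-* _ (λ k → ∑inner≤3 _ (uniform _ (∈-lookup k)) (all-32 _ (∈-lookup k))) ⟩
  length E * 3                            ≡⟨ *-comm (length E) 3 ⟩
  3 * length E                            ∎
  where
  open ≤-Reasoning
  2≤edge-count : ∀ i → 2 ≤ ∑ᴸ E (λ e → inner e i)
  2≤edge-count i with cycle⊆EI i
  ... | e₁ , e₂ , e₁∈E , e₂∈E , e₁≢e₂ , e₁∩e₂≡i,i+1 =
    2≤∑ᴸ E (λ e → inner e i) e₁∈E e₂∈E e₁≢e₂ (≤-reflexive (sym inner₁)) (≤-reflexive (sym inner₂))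
    where
    inner₁ : inner e₁ i ≡ 1
    inner₁ = proj₁ (inner-∩ e₁ e₂ e₁∩e₂≡i,i+1)
    inner₂ : inner e₂ i ≡ 1
    inner₂ = proj₂ (inner-∩ e₁ e₂ e₁∩e₂≡i,i+1)
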